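{- Let $C : \mathsf{Form} \to \mathsf{Prop}$ be any predicate, $\mathsf{Code}$ any type and $\mathsf{eval} : \mathsf{Code} \to \mathsf{Code} \to \mathsf{Form}$ any function, and assume evaluation completeness: for every function $f : \mathsf{Code} \to \mathsf{Form}$ there exists $c \in \mathsf{Code}$ such that for all $x \in \mathsf{Code}$, $\mathsf{eval}(c,x) \simeq_C f(x)$. Then there exists a formula $B$ with $B \simeq_C \neg B$.
   Context: $\mathsf{Form}$ is the type of closed formulas generated by $A,B ::= \bot \mid A \to B$; $\neg A$ abbreviates $A \to \bot$. For a predicate $C$ on $\mathsf{Form}$, $A \simeq_C B$ means $C(A \to B) \land C(B \to A)$. -}

module Defs where

open import Data.Product using (_×_)

data Form : Set where
  bot : Form
  _⇒_ : Form → Form → Form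

infixr 5 _⇒_

neg : Form → Form
neg A = A ⇒ bot

_≃[_]_ : Form → (Form → Set) → Form → Set
A ≃[ C ] B = C (A ⇒ B) × C (B ⇒ A)

{-# OPTIONS --safe #-}
module Submission where

open import Defs
open import Data.Product using (Σ; _,_)

fixed-point : (C : Form → Set) {Code : Set} (eval : Code → Code → Form)
    → ((f : Code → Form) → Σ Code (λ c → (x : Code) → eval c x ≃[ C ] f x))
    → (g : Form → Form) → Σ Form (λ B → B ≃[ C ] g B)
fixed-point C eval complete g with complete (λ x → g (eval x x))
... | c , eval-c≃ = eval c c , eval-c≃ c

theorem3p4 : (C : Form → Set) (Code : Set) (eval : Code → Code → Form)
    → ((f : Code → Form) → Σ Code (λ c → (x : Code) → eval c x ≃[ C ] f x))
    → Σ Form (λ B → B ≃[ C ] neg B)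
theorem3p4 C Code eval complete = fixed-point C eval complete neg
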